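{- Let $n\ge 2$ and let $m$ be an integer with $\lceil \log_2 n\rceil\le m\le n$. Then there exists a finite $T_0$-space (poset) $X$ with $|X|=n$ and $d(X)=m$. Moreover, if $m\neq n$, $X$ can be taken to be contractible.
   Context: Finite posets are identified with finite $T_0$-spaces via the order $x\le y$ iff $x$ belongs to every open set containing $y$. A space is contractible if it is homotopy equivalent to a point. The $2$-dimension $d(X)$ of a finite $T_0$-space $X$ is the minimum $k\in\mathbb{N}_0$ such that $X$ is homeomorphic to a subspace of $\mathfrak{S}^k$, where $\mathfrak{S}=\{0,1\}$ is the Sierpinski space with unique proper nonempty open set $\{0\}$; equivalently, the minimum $k$ such that $X$ embeds as a subposet of $\{0,1\}^k$ with the product order. -}

module Defs where

open import Level using (0ℓ)
open import Data.Nat using (ℕ; _≤_)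
open import Data.Fin using (Fin)
open import Data.Bool using (Bool) renaming (_≤_ to _≤𝔹_)
open import Data.Product using (Σ; _×_; _,_; proj₁)
open import Function.Definitions using (Injective)
open import Relation.Binary.PropositionalEquality using (_≡_)
open import Relation.Binary.Core using (Rel)
open import Relation.Binary.Structures using (IsPartialOrder)
open import Relation.Binary.Construct.Closure.Equivalence using (EqClosure)

-- A finite T₀-space with n points, presented as a partial order on Fin n
-- (x ≤ y iff x lies in every open set containing y).
record FinPoset (n : ℕ) : Set₁ where
  field
    _≼_       : Rel (Fin n) 0ℓ
    isPartialOrder : IsPartialOrder _≡_ _≼_
open FinPoset public

-- The Sierpinski space 𝔖 = {0,1} with unique proper nonempty open set {0}
-- is the poset 0 < 1; we encode 0 as false, 1 as true, ordered by
-- Data.Bool's _≤_ (false ≤ true).  𝔖^k is Fin k → Bool with the product order.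
_≤ₚ_ : {k : ℕ} → (Fin k → Bool) → (Fin k → Bool) → Set
u ≤ₚ v = ∀ i → u i ≤𝔹 v i

-- X is homeomorphic to a subspace of 𝔖^k: an injective map e : X → 𝔖^k
-- with x ≤ y ⇔ e x ≤ e y.
EmbedsIn : {n : ℕ} → FinPoset n → ℕ → Set
EmbedsIn {n} X k =
  Σ (Fin n → (Fin k → Bool)) λ e →
    Injective _≡_ _≡_ e ×
    (∀ x y → (_≼_ X x y → e x ≤ₚ e y) × (e x ≤ₚ e y → _≼_ X x y))

HasTwoDim : {n : ℕ} → FinPoset n → ℕ → Set
HasTwoDim X m = EmbedsIn X m × (∀ k → EmbedsIn X k → m ≤ k)

-- Continuous self-maps of X = order-preserving maps.
Map : {n : ℕ} → FinPoset n → Set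
Map {n} X = Σ (Fin n → Fin n) λ f → ∀ x y → _≼_ X x y → _≼_ X (f x) (f y)

_≤ᴹ_ : {n : ℕ} {X : FinPoset n} → Rel (Map X) 0ℓ
_≤ᴹ_ {X = X} f g = ∀ x → _≼_ X (proj₁ f x) (proj₁ g x)

-- Homotopy of maps between finite T₀-spaces: f ≃ g iff there is a fence
-- f = f₀ ≤ f₁ ≥ f₂ ≤ … fₖ = g of continuous maps (Barmak, Cor. 1.2.6),
-- i.e. the equivalence closure of the pointwise order.
Homotopic : {n : ℕ} (X : FinPoset n) → Rel (Map X) 0ℓ
Homotopic X = EqClosure (_≤ᴹ_ {X = X})

idMap : {n : ℕ} (X : FinPoset n) → Map X
idMap X = (λ x → x) , λ x y p → p

constMap : {n : ℕ} (X : FinPoset n) → Fin n → Map X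
constMap X c = (λ _ → c) , λ x y p → IsPartialOrder.refl (isPartialOrder X)

Contractible : {n : ℕ} → FinPoset n → Set
Contractible {n} X = Σ (Fin n) λ c → Homotopic X (idMap X) (constMap X c)

{-# OPTIONS --safe #-}
-- Along a strict chain in 𝔖^k the number of 1-coordinates strictly increases, so a chain
-- with L steps in a subspace of 𝔖^k forces L ≤ k, and even L + 2 ≤ k when the bottom of the
-- chain is not below some point (hence is not 0⋯0) and its top is not above some point
-- (hence is not 1⋯1).
-- For m < n ≤ 2^m take n distinct points of 𝔖^m including the chain 0⋯0 < 10⋯0 < ⋯ < 1⋯1:
-- it has m steps, and the minimum 0⋯0 makes the space contractible.
-- For m = n take the point 10⋯0 together with the chain 010⋯0 < 0110⋯0 < ⋯ < 01⋯1 of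
-- n − 1 points, none of which is comparable with it.
module Submission where

open import Defs
open import Data.Nat using (ℕ; _≤_)
open import Data.Nat.Logarithm using (⌈log₂_⌉)
open import Data.Product using (Σ; _×_)
open import Relation.Binary.PropositionalEquality using (_≢_)

open import Level using (Level; 0ℓ)
open import Function using (_∘_; id; const)
open import Data.Bool using (Bool; true; false; if_then_else_) renaming (_≤_ to _≤𝔹_)
open import Data.Bool.Base using (f≤t; b≤b)
import Data.Bool.Properties as 𝔹
open import Data.Nat using (zero; suc; _+_; _∸_; _*_; _^_; _<_; _>_; _<?_; _≟_; z≤n; s≤s; ⌈_/2⌉)
open import Data.Nat.Properties
open import Data.Nat.Logarithm.Core using (⌈log2⌉)
open import Data.Nat.Induction using (<-wellFounded)
open import Induction.WellFounded using (Acc; acc)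
open import Data.Fin using (Fin; toℕ; inject₁; inject≤; fromℕ) renaming (zero to fzero; suc to fsuc)
open import Data.Fin.Properties using (toℕ<n; toℕ-inject₁; toℕ-inject≤; toℕ-injective)
open import Data.Vec.Functional using (Vector; []; _∷_; head; tail; init; last)
open import Data.Product using (_,_; proj₁; proj₂)
open import Relation.Nullary using (¬_; yes; no; contradiction)
open import Relation.Binary.Core using (Rel)
open import Relation.Binary.PropositionalEquality
  using (_≡_; _≗_; refl; sym; cong; cong₂; cong-app; subst; subst₂; isEquivalence; module ≡-Reasoning)
open import Relation.Binary.Construct.Closure.ReflexiveTransitive using (ε; _◅_)
open import Relation.Binary.Construct.Closure.Symmetric using (bwd)

private variable
  a ℓ : Level
  A : Set a
  k m n L : ℕ

n<2^n : ∀ n → n < 2 ^ n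
n<2^n zero    = s≤s z≤n
n<2^n (suc n) = +-mono-≤ (m^n>0 2 n) (≤-trans (n<2^n n) (m≤m+n _ 0))

suc[m∸n]<n : ∀ {m n} → n ≤ m → suc m < 2 * n → suc (m ∸ n) < n
suc[m∸n]<n {m} {n} n≤m m<2n = +-cancelʳ-< n (suc (m ∸ n)) n
  (subst₂ _<_ (cong suc (sym (m∸n+n≡m n≤m))) (cong (n +_) (+-identityʳ n)) m<2n)

n≤2*⌈n/2⌉ : ∀ n → n ≤ 2 * ⌈ n /2⌉
n≤2*⌈n/2⌉ zero          = z≤n
n≤2*⌈n/2⌉ (suc zero)    = s≤s z≤n
n≤2*⌈n/2⌉ (suc (suc n)) =
  s≤s (≤-trans (s≤s (n≤2*⌈n/2⌉ n)) (≤-reflexive (sym (+-suc ⌈ n /2⌉ (⌈ n /2⌉ + 0)))))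

n≤2^⌈log₂n⌉ : ∀ n → n ≤ 2 ^ ⌈log₂ n ⌉
n≤2^⌈log₂n⌉ n = go n (<-wellFounded n)
  where
  go : ∀ n (rec : Acc _<_ n) → n ≤ 2 ^ ⌈log2⌉ n rec
  go zero          _         = z≤n
  go (suc zero)    _         = s≤s z≤n
  go (suc (suc n)) (acc rec) = ≤-trans (n≤2*⌈n/2⌉ (suc (suc n)))
    (*-monoʳ-≤ 2 (go (suc ⌈ n /2⌉) (rec (⌈n/2⌉<n n))))

Strict : Rel A ℓ → Rel A ℓ
Strict _≤_ x y = x ≤ y × ¬ (y ≤ x)

Chain : Rel A ℓ → Vector A (suc L) → Set ℓ
Chain _<_ c = ∀ j → init c j < tail c j

head+length≤last : (h : Vector ℕ (suc L)) → Chain _<_ h → head h + L ≤ last h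
head+length≤last {zero}  h _  = ≤-reflexive (+-identityʳ (head h))
head+length≤last {suc L} h h↑ = begin
  head h + suc L     ≡⟨ +-suc (head h) L ⟩
  suc (head h) + L   ≤⟨ +-monoˡ-≤ L (h↑ fzero) ⟩
  head (tail h) + L  ≤⟨ head+length≤last (tail h) (h↑ ∘ fsuc) ⟩
  last h             ∎
  where open ≤-Reasoning

_<ₚ_ : Rel (Vector Bool k) 0ℓ
_<ₚ_ = Strict _≤ₚ_

⊥ₚ ⊤ₚ : Vector Bool k
⊥ₚ _ = false
⊤ₚ _ = true

∷-≤ₚ : ∀ {x y} {u v : Vector Bool k} → x ≤𝔹 y → u ≤ₚ v → (x ∷ u) ≤ₚ (y ∷ v)
∷-≤ₚ x≤y u≤v fzero    = x≤y
∷-≤ₚ x≤y u≤v (fsuc i) = u≤v i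

∷-<ₚ : ∀ {x y} {u v : Vector Bool k} → x ≤𝔹 y → u <ₚ v → (x ∷ u) <ₚ (y ∷ v)
∷-<ₚ x≤y (u≤v , v≰u) = ∷-≤ₚ x≤y u≤v , v≰u ∘ (_∘ fsuc)

false∷<ₚtrue∷ : {u v : Vector Bool k} → u ≤ₚ v → (false ∷ u) <ₚ (true ∷ v)
false∷<ₚtrue∷ u≤v = ∷-≤ₚ f≤t u≤v , λ v≤u → contradiction (v≤u fzero) λ ()

weight : Vector Bool k → ℕ
weight {zero}  _ = 0
weight {suc k} u = (if head u then 1 else 0) + weight (tail u)

weight-⊥ₚ : weight (⊥ₚ {k}) ≡ 0
weight-⊥ₚ {zero}  = refl
weight-⊥ₚ {suc k} = weight-⊥ₚ {k}

weight-⊤ₚ : weight (⊤ₚ {k}) ≡ k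
weight-⊤ₚ {zero}  = refl
weight-⊤ₚ {suc k} = cong suc (weight-⊤ₚ {k})

weight-mono : {u v : Vector Bool k} → u ≤ₚ v → weight u ≤ weight v
weight-mono {zero}  _   = z≤n
weight-mono {suc k} u≤v = +-mono-≤ (bit-mono (u≤v fzero)) (weight-mono (u≤v ∘ fsuc))
  where
  bit-mono : ∀ {x y} → x ≤𝔹 y → (if x then 1 else 0) ≤ (if y then 1 else 0)
  bit-mono f≤t = z≤n
  bit-mono b≤b = ≤-refl

weight-strictMono : {u v : Vector Bool k} → u <ₚ v → weight u < weight v
weight-strictMono {zero}  (_ , v≰u)   = contradiction (λ ()) v≰u
weight-strictMono {suc k} (u≤v , v≰u) =
  bit-strict (u≤v fzero) (weight-mono (u≤v ∘ fsuc)) λ v₀≤u₀ →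
    weight-strictMono ((u≤v ∘ fsuc) , λ v′≤u′ → v≰u λ { fzero → v₀≤u₀ ; (fsuc i) → v′≤u′ i })
  where
  bit-strict : ∀ {x y p q} → x ≤𝔹 y → p ≤ q → (y ≤𝔹 x → p < q) →
               (if x then 1 else 0) + p < (if y then 1 else 0) + q
  bit-strict f≤t p≤q _    = s≤s p≤q
  bit-strict b≤b _   p<q = +-monoʳ-< _ (p<q b≤b)

weight≤dim : (u : Vector Bool k) → weight u ≤ k
weight≤dim {k} u = subst (weight u ≤_) (weight-⊤ₚ {k}) (weight-mono λ i → 𝔹.≤-maximum (u i))

≰⇒weight>0 : {u v : Vector Bool k} → ¬ (u ≤ₚ v) → weight u > 0
≰⇒weight>0 {k} {u} u≰v = subst (_< weight u) (weight-⊥ₚ {k})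
  (weight-strictMono ((λ i → 𝔹.≤-minimum (u i)) , λ u≤⊥ → u≰v λ i → 𝔹.≤-trans (u≤⊥ i) (𝔹.≤-minimum _)))

≱⇒weight<dim : {u v : Vector Bool k} → ¬ (v ≤ₚ u) → weight u < k
≱⇒weight<dim {k} {u} v≰u = subst (weight u <_) (weight-⊤ₚ {k})
  (weight-strictMono ((λ i → 𝔹.≤-maximum (u i)) , λ ⊤≤u → v≰u λ i → 𝔹.≤-trans (𝔹.≤-maximum _) (⊤≤u i)))

chain-weight : (u : Vector (Vector Bool k) (suc L)) → Chain _<ₚ_ u → weight (head u) + L ≤ weight (last u)
chain-weight u u↑ = head+length≤last (weight ∘ u) (weight-strictMono ∘ u↑)

-- enum m lists 𝔖^m without repetition on [0, 2^m) and begins with the maximal chain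
-- enum m j = 1^j 0^(m−j), j ≤ m: after 0⋯0 come the vectors 1 ∷ enum m i for i < 2^m,
-- then 0 ∷ the non-zero entries of enum m.
enum : ∀ m → ℕ → Vector Bool m
enum zero    _       = []
enum (suc m) zero    = false ∷ enum m zero
enum (suc m) (suc i) with i <? 2 ^ m
... | yes _ = true  ∷ enum m i
... | no  _ = false ∷ enum m (suc (i ∸ 2 ^ m))

position-∷ : ℕ → Bool → ℕ → ℕ
position-∷ m true  p       = suc p
position-∷ m false zero    = zero
position-∷ m false (suc p) = suc p + 2 ^ m

position : ∀ m → Vector Bool m → ℕ
position zero    _ = 0
position (suc m) u = position-∷ m (head u) (position m (tail u))

position-cong : {u v : Vector Bool m} → u ≗ v → position m u ≡ position m v
position-cong {zero}  _   = refl
position-cong {suc m} u≗v = cong₂ (position-∷ m) (u≗v fzero) (position-cong (u≗v ∘ fsuc))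

position-enum : ∀ m i → i < 2 ^ m → position m (enum m i) ≡ i
position-enum zero    zero    _         = refl
position-enum zero    (suc i) (s≤s ())
position-enum (suc m) zero    _ = cong (position-∷ m false) (position-enum m zero (m^n>0 2 m))
position-enum (suc m) (suc i) i<2^[1+m] with i <? 2 ^ m
... | yes i<2^m = cong suc (position-enum m i i<2^m)
... | no  i≮2^m = begin
  position-∷ m false (position m (enum m (suc (i ∸ 2 ^ m))))
    ≡⟨ cong (position-∷ m false) (position-enum m _ (suc[m∸n]<n 2^m≤i i<2^[1+m])) ⟩
  suc (i ∸ 2 ^ m) + 2 ^ m
    ≡⟨ cong suc (m∸n+n≡m 2^m≤i) ⟩
  suc i ∎
  where
  open ≡-Reasoning
  2^m≤i : 2 ^ m ≤ i
  2^m≤i = ≮⇒≥ i≮2^m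

enum-injective : ∀ {i j} → i < 2 ^ m → j < 2 ^ m → enum m i ≗ enum m j → i ≡ j
enum-injective {m} {i} {j} i<2^m j<2^m eq = begin
  i                      ≡⟨ sym (position-enum m i i<2^m) ⟩
  position m (enum m i)  ≡⟨ position-cong eq ⟩
  position m (enum m j)  ≡⟨ position-enum m j j<2^m ⟩
  j                      ∎
  where open ≡-Reasoning

enum-zero-minimum : ∀ m (u : Vector Bool m) → enum m zero ≤ₚ u
enum-zero-minimum (suc m) u fzero    = 𝔹.≤-minimum (u fzero)
enum-zero-minimum (suc m) u (fsuc i) = enum-zero-minimum m (tail u) i

enum-<ₚ : ∀ {j} → j < m → enum m j <ₚ enum m (suc j)
enum-<ₚ {suc m} {zero} _ with 0 <? 2 ^ m
... | yes _     = false∷<ₚtrue∷ (λ _ → b≤b)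
... | no  0≮2^m = contradiction (m^n>0 2 m) 0≮2^m
enum-<ₚ {suc m} {suc j} (s≤s j<m) with j <? 2 ^ m | suc j <? 2 ^ m
... | yes _   | yes _     = ∷-<ₚ b≤b (enum-<ₚ j<m)
... | no  j≮  | _         = contradiction (<-trans j<m (n<2^n m)) j≮
... | yes _   | no  1+j≮  = contradiction (≤-<-trans j<m (n<2^n m)) 1+j≮

induced : (v : Fin n → Vector Bool k) → (∀ {x y} → v x ≗ v y → x ≡ y) → FinPoset n
induced v v-injective = record
  { _≼_            = λ x y → v x ≤ₚ v y
  ; isPartialOrder = record
    { isPreorder = record
      { isEquivalence = isEquivalence
      ; reflexive     = λ { refl _ → b≤b }
      ; trans         = λ p q i → 𝔹.≤-trans (p i) (q i)
      }
    ; antisym    = λ p q → v-injective λ i → 𝔹.≤-antisym (p i) (q i)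
    }
  }

induced-embeds : (v : Fin n → Vector Bool k) (v-injective : ∀ {x y} → v x ≗ v y → x ≡ y) →
                 EmbedsIn (induced v v-injective) k
induced-embeds v v-injective = v , v-injective ∘ cong-app , λ _ _ → id , id

minimum⇒contractible : (X : FinPoset n) (c : Fin n) → (∀ x → _≼_ X c x) → Contractible X
minimum⇒contractible X c c≼ = c , bwd c≼ ◅ ε

strict-embedded : (X : FinPoset n) ((e , _) : EmbedsIn X k) →
                  ∀ {x y} → Strict (_≼_ X) x y → e x <ₚ e y
strict-embedded X (e , _ , e-embedding) (x≼y , y⋠x) =
  proj₁ (e-embedding _ _) x≼y , y⋠x ∘ proj₂ (e-embedding _ _)

chain≤dim : (X : FinPoset n) → EmbedsIn X k →
            {c : Vector (Fin n) (suc L)} → Chain (Strict (_≼_ X)) c → L ≤ k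
chain≤dim {k = k} {L = L} X E@(e , _) {c} c↑ = begin
  L                         ≤⟨ m≤n+m L _ ⟩
  weight (e (head c)) + L   ≤⟨ chain-weight (e ∘ c) (strict-embedded X E ∘ c↑) ⟩
  weight (e (last c))       ≤⟨ weight≤dim _ ⟩
  k                         ∎
  where open ≤-Reasoning

chain+2≤dim : (X : FinPoset n) → EmbedsIn X k →
              {c : Vector (Fin n) (suc L)} → Chain (Strict (_≼_ X)) c →
              ∀ {p} → ¬ _≼_ X (head c) p → ¬ _≼_ X p (last c) → 2 + L ≤ k
chain+2≤dim {k = k} {L = L} X E@(e , _ , e-embedding) {c} c↑ c₀⋠p p⋠cₗ = begin
  2 + L                           ≤⟨ s≤s (+-monoˡ-≤ L (≰⇒weight>0 (c₀⋠p ∘ proj₂ (e-embedding _ _)))) ⟩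
  suc (weight (e (head c)) + L)   ≤⟨ s≤s (chain-weight (e ∘ c) (strict-embedded X E ∘ c↑)) ⟩
  suc (weight (e (last c)))       ≤⟨ ≱⇒weight<dim (p⋠cₗ ∘ proj₂ (e-embedding _ _)) ⟩
  k                               ∎
  where open ≤-Reasoning

contractibleWithTwoDim : m < n → n ≤ 2 ^ m → Σ (FinPoset n) λ X → HasTwoDim X m × Contractible X
contractibleWithTwoDim {m} {suc n} m<n n≤2^m =
  X , (induced-embeds point point-injective , λ _ E → chain≤dim X E {c = chain} chain↑) ,
  minimum⇒contractible X fzero (enum-zero-minimum m ∘ point)
  where
  point : Fin (suc n) → Vector Bool m
  point x = enum m (toℕ x)

  point-injective : ∀ {x y} → point x ≗ point y → x ≡ y
  point-injective {x} {y} = toℕ-injective ∘ enum-injective (<2^m x) (<2^m y)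
    where
    <2^m : (z : Fin (suc n)) → toℕ z < 2 ^ m
    <2^m z = <-≤-trans (toℕ<n z) n≤2^m

  X : FinPoset (suc n)
  X = induced point point-injective

  chain : Vector (Fin (suc n)) (suc m)
  chain j = inject≤ j m<n

  chain↑ : ∀ j → enum m (toℕ (inject≤ (inject₁ j) m<n)) <ₚ enum m (toℕ (inject≤ (fsuc j) m<n))
  chain↑ j rewrite toℕ-inject≤ (inject₁ j) m<n | toℕ-inject₁ j | toℕ-inject≤ (fsuc j) m<n =
    enum-<ₚ (toℕ<n j)

twoDimEqualToSize : 2 ≤ n → Σ (FinPoset n) λ X → HasTwoDim X n
twoDimEqualToSize {suc zero} (s≤s ())
twoDimEqualToSize {suc (suc L)} _ =
  X , induced-embeds point point-injective ,
  λ _ E → chain+2≤dim X E {c = fsuc} chain↑ {p = fzero} c₀⋠p p⋠cₗ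
  where
  point : Fin (2 + L) → Vector Bool (2 + L)
  point fzero    = true ∷ ⊥ₚ
  point (fsuc j) = false ∷ enum (suc L) (suc (toℕ j))

  point-injective : ∀ {x y} → point x ≗ point y → x ≡ y
  point-injective {fzero}  {fzero}  _  = refl
  point-injective {fzero}  {fsuc _} eq = contradiction (eq fzero) λ ()
  point-injective {fsuc _} {fzero}  eq = contradiction (eq fzero) λ ()
  point-injective {fsuc x} {fsuc y} eq =
    cong fsuc (toℕ-injective (suc-injective (enum-injective (<2^[1+L] x) (<2^[1+L] y) (eq ∘ fsuc))))
    where
    <2^[1+L] : (z : Fin (suc L)) → suc (toℕ z) < 2 ^ suc L
    <2^[1+L] z = ≤-<-trans (toℕ<n z) (n<2^n (suc L))

  X : FinPoset (2 + L)
  X = induced point point-injective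

  chain↑ : ∀ j → (false ∷ enum (suc L) (suc (toℕ (inject₁ j)))) <ₚ (false ∷ enum (suc L) (suc (suc (toℕ j))))
  chain↑ j rewrite toℕ-inject₁ j = ∷-<ₚ b≤b (enum-<ₚ (s≤s (toℕ<n j)))

  c₀⋠p : ¬ (point (fsuc fzero) ≤ₚ point fzero)
  c₀⋠p c₀≤p = proj₂ (enum-<ₚ (s≤s z≤n)) λ i → 𝔹.≤-trans (c₀≤p (fsuc i)) (𝔹.≤-minimum _)

  p⋠cₗ : ¬ (point fzero ≤ₚ point (fsuc (fromℕ L)))
  p⋠cₗ p≤cₗ = contradiction (p≤cₗ fzero) λ ()

mainTheorem7 : (n m : ℕ) → 2 ≤ n → ⌈log₂ n ⌉ ≤ m → m ≤ n →
    Σ (FinPoset n) λ X → HasTwoDim X m × (m ≢ n → Contractible X)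
mainTheorem7 n m 2≤n ⌈log₂n⌉≤m m≤n with m ≟ n
... | yes refl = let (X , X-dim) = twoDimEqualToSize 2≤n in X , X-dim , λ n≢n → contradiction refl n≢n
... | no  m≢n  = let (X , X-dim , X-contractible) = contractibleWithTwoDim m<n n≤2^m in X , X-dim , const X-contractible
  where
  m<n : m < n
  m<n = ≤∧≢⇒< m≤n m≢n
  n≤2^m : n ≤ 2 ^ m
  n≤2^m = ≤-trans (n≤2^⌈log₂n⌉ n) (^-monoʳ-≤ 2 ⌈log₂n⌉≤m)
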